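{- Let $k$ be a positive integer. For a positive integer $n$ and $r,s\in\mathbb N_0$, the following conditions are equivalent: (i) $k^2-k+1\le n\le k^2$, $r\le s$, $rs=n$, and $r+s\le 2k$; (ii) $k^2-k+1\le n\le k^2$, $r\le s$, $rs=n$, and $r+s=2k$; (iii) there is $l\in\mathbb N_0$ such that $l^2\le k-1$, $n=k^2-l^2$, $r=k-l$ and $s=k+l$.
   Context: $\mathbb N_0$ denotes the set of non-negative integers. -}

module Defs where

open import Data.Nat using (ℕ; _+_; _*_; _∸_; _≤_)
open import Data.Product using (_×_; ∃-syntax)
open import Relation.Binary.PropositionalEquality using (_≡_)

-- k² - k + 1 ≤ n ≤ k²  (note k*k ∸ k is the true difference since k ≤ k*k for k ≥ 1)
InRange : ℕ → ℕ → Set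
InRange k n = (k * k ∸ k + 1 ≤ n) × (n ≤ k * k)

CondI : ℕ → ℕ → ℕ → ℕ → Set
CondI k n r s = InRange k n × (r ≤ s) × (r * s ≡ n) × (r + s ≤ 2 * k)

CondII : ℕ → ℕ → ℕ → ℕ → Set
CondII k n r s = InRange k n × (r ≤ s) × (r * s ≡ n) × (r + s ≡ 2 * k)

-- l² ≤ k-1 guarantees l < k, so k*k ∸ l*l and k ∸ l are true differences
CondIII : ℕ → ℕ → ℕ → ℕ → Set
CondIII k n r s = ∃[ l ] ((l * l ≤ k ∸ 1) × (n ≡ k * k ∸ l * l) × (r ≡ k ∸ l) × (s ≡ k + l))

-- If r ≤ s and r + s = 2k then r = k − l and s = k + l with l = k − r, so rs = k² − l², and
-- k² − k + 1 ≤ k² − l² says exactly l² ≤ k − 1. Weakening r + s = 2k to r + s ≤ 2k changes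
-- nothing: by AM-GM, r + s ≤ 2k − 1 forces 4rs ≤ (2k − 1)² < 4(k² − k + 1), so rs lies below
-- the range.
module Submission where

open import Defs
open import Data.Nat using (ℕ; NonZero; suc; _+_; _*_; _∸_; _≤_; _<_; z≤n; z<s; s≤s⁻¹)
open import Data.Nat.Properties
open import Data.Nat.Tactic.RingSolver using (solve-∀)
open import Data.Product using (_×_; _,_)
open import Data.Sum using ([_,_]′)
open import Function.Bundles using (_⇔_; mk⇔; Equivalence)
open import Relation.Binary.PropositionalEquality
open import Relation.Nullary using (contradiction; yes; no)

4*[m*n]≤[m+n]*[m+n] : ∀ m n → 4 * (m * n) ≤ (m + n) * (m + n)
4*[m*n]≤[m+n]*[m+n] m n = [ ordered m n , swapped ]′ (≤-total m n)
  where
  square-of-sum : ∀ m d → 4 * (m * (m + d)) + d * d ≡ (m + (m + d)) * (m + (m + d))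
  square-of-sum = solve-∀

  ordered : ∀ m n → m ≤ n → 4 * (m * n) ≤ (m + n) * (m + n)
  ordered m n m≤n with n ∸ m | m+[n∸m]≡n m≤n
  ... | d | refl = subst (4 * (m * (m + d)) ≤_) (square-of-sum m d) (m≤m+n _ (d * d))

  swapped : n ≤ m → 4 * (m * n) ≤ (m + n) * (m + n)
  swapped n≤m = subst₂ _≤_ (cong (4 *_) (*-comm n m)) (cong (λ x → x * x) (+-comm n m))
    (ordered n m n≤m)

m+n≤1+2j⇒m*n≤j*[1+j] : ∀ {m n} j → m + n ≤ suc (2 * j) → m * n ≤ j * suc j
m+n≤1+2j⇒m*n≤j*[1+j] {m} {n} j m+n≤1+2j = s≤s⁻¹ (*-cancelˡ-< 4 (m * n) (suc (j * suc j)) (begin-strict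
  4 * (m * n)                          ≤⟨ 4*[m*n]≤[m+n]*[m+n] m n ⟩
  (m + n) * (m + n)                    ≤⟨ *-mono-≤ m+n≤1+2j m+n≤1+2j ⟩
  suc (2 * j) * suc (2 * j)            <⟨ m<m+n _ {3} z<s ⟩
  suc (2 * j) * suc (2 * j) + 3        ≡⟨ odd-square j ⟩
  4 * suc (j * suc j)                  ∎))
  where
  open ≤-Reasoning
  odd-square : ∀ j → suc (2 * j) * suc (2 * j) + 3 ≡ 4 * suc (j * suc j)
  odd-square = solve-∀

[m∸n]*[m+n]≡m*m∸n*n : ∀ {m n} → n ≤ m → (m ∸ n) * (m + n) ≡ m * m ∸ n * n
[m∸n]*[m+n]≡m*m∸n*n {m} {n} n≤m with m ∸ n | m∸n+n≡m n≤m
... | t | refl = sym (begin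
  (t + n) * (t + n) ∸ n * n        ≡⟨ cong (_∸ n * n) (square-of-sum t n) ⟩
  t * (t + n + n) + n * n ∸ n * n  ≡⟨ m+n∸n≡m _ (n * n) ⟩
  t * (t + n + n)                  ∎)
  where
  open ≡-Reasoning
  square-of-sum : ∀ t n → (t + n) * (t + n) ≡ t * (t + n + n) + n * n
  square-of-sum = solve-∀

m≤m*m : ∀ m → m ≤ m * m
m≤m*m 0       = z≤n
m≤m*m (suc m) = m≤m*n (suc m) (suc m)

m∸[1+n]+1≡m∸n : ∀ {m n} → suc n ≤ m → m ∸ suc n + 1 ≡ m ∸ n
m∸[1+n]+1≡m∸n {m} {n} 1+n≤m = begin
  m ∸ suc n + 1    ≡⟨ +-∸-comm 1 1+n≤m ⟨
  m + 1 ∸ suc n    ≡⟨ cong (_∸ suc n) (+-comm m 1) ⟩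
  m ∸ n            ∎
  where open ≡-Reasoning

inRange⇒j*[1+j]<n : ∀ {j n} → InRange (suc j) n → j * suc j < n
inRange⇒j*[1+j]<n {j} {n} (lower , _) =
  subst (_≤ n) (trans (cong (_+ 1) (m+n∸m≡n (suc j) (j * suc j))) (+-comm _ 1)) lower

inRange[k*k∸x]⇔x≤k∸1 : ∀ {x} j → let k = suc j in
                        x ≤ k * k → InRange k (k * k ∸ x) ⇔ x ≤ j
inRange[k*k∸x]⇔x≤k∸1 {x} j x≤k*k = mk⇔
  (λ (lower , _) → ∸-cancelʳ-≤ x≤k*k (subst (_≤ k * k ∸ x) k*k∸k+1≡k*k∸j lower))
  (λ x≤j → subst (_≤ k * k ∸ x) (sym k*k∸k+1≡k*k∸j) (∸-monoʳ-≤ (k * k) x≤j) , m∸n≤m (k * k) x)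
  where
  k : ℕ
  k = suc j
  k*k∸k+1≡k*k∸j : k * k ∸ k + 1 ≡ k * k ∸ j
  k*k∸k+1≡k*k∸j = m∸[1+n]+1≡m∸n (m≤m*m k)

m≤n∧m+n≡2k⇒m≤k : ∀ {m n} k → m ≤ n → m + n ≡ 2 * k → m ≤ k
m≤n∧m+n≡2k⇒m≤k {m} {n} k m≤n m+n≡2k = *-cancelˡ-≤ 2 (begin
  2 * m        ≤⟨ +-monoʳ-≤ m (≤-trans (≤-reflexive (+-identityʳ m)) m≤n) ⟩
  m + n        ≡⟨ m+n≡2k ⟩
  2 * k        ∎)
  where open ≤-Reasoning

m+n≡2k⇒n≡k+[k∸m] : ∀ {m n} k → m ≤ k → m + n ≡ 2 * k → n ≡ k + (k ∸ m)
m+n≡2k⇒n≡k+[k∸m] {m} {n} k m≤k m+n≡2k = +-cancelˡ-≡ m n (k + (k ∸ m)) (begin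
  m + n              ≡⟨ m+n≡2k ⟩
  k + (k + 0)        ≡⟨ cong (k +_) (+-identityʳ k) ⟩
  k + k              ≡⟨ cong (k +_) (m+[n∸m]≡n m≤k) ⟨
  k + (m + (k ∸ m))  ≡⟨ +-assoc k m (k ∸ m) ⟨
  k + m + (k ∸ m)    ≡⟨ cong (_+ (k ∸ m)) (+-comm k m) ⟩
  m + k + (k ∸ m)    ≡⟨ +-assoc m k (k ∸ m) ⟩
  m + (k + (k ∸ m))  ∎)
  where open ≡-Reasoning

[k∸l]+[k+l]≡2k : ∀ {k l} → l ≤ k → (k ∸ l) + (k + l) ≡ 2 * k
[k∸l]+[k+l]≡2k {k} {l} l≤k = begin
  (k ∸ l) + (k + l)  ≡⟨ cong ((k ∸ l) +_) (+-comm k l) ⟩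
  (k ∸ l) + (l + k)  ≡⟨ +-assoc (k ∸ l) l k ⟨
  (k ∸ l) + l + k    ≡⟨ cong (_+ k) (m∸n+n≡m l≤k) ⟩
  k + k              ≡⟨ cong (k +_) (+-identityʳ k) ⟨
  2 * k              ∎
  where open ≡-Reasoning

module _ (j : ℕ) {n r s : ℕ} where
  private
    k : ℕ
    k = suc j

  condI⇒condII : CondI k n r s → CondII k n r s
  condI⇒condII (range , r≤s , r*s≡n , r+s≤2k) = range , r≤s , r*s≡n , r+s≡2k
    where
    r+s≡2k : r + s ≡ 2 * k
    r+s≡2k with r + s ≟ 2 * k
    ... | yes eq = eq
    ... | no r+s≢2k = contradiction (inRange⇒j*[1+j]<n {j} range) (≤⇒≯ (begin
      n          ≡⟨ r*s≡n ⟨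
      r * s      ≤⟨ m+n≤1+2j⇒m*n≤j*[1+j] {r} {s} j r+s≤1+2j ⟩
      j * suc j  ∎))
      where
      open ≤-Reasoning
      r+s≤1+2j : r + s ≤ suc (2 * j)
      r+s≤1+2j = subst (r + s ≤_) (+-suc j (j + 0)) (s≤s⁻¹ (≤∧≢⇒< r+s≤2k r+s≢2k))

  condII⇒condI : CondII k n r s → CondI k n r s
  condII⇒condI (range , r≤s , r*s≡n , r+s≡2k) = range , r≤s , r*s≡n , ≤-reflexive r+s≡2k

  condII⇒condIII : CondII k n r s → CondIII k n r s
  condII⇒condIII (range , r≤s , r*s≡n , r+s≡2k) = l , l*l≤j , n≡k*k∸l*l , r≡k∸l , s≡k+l
    where
    r≤k : r ≤ k
    r≤k = m≤n∧m+n≡2k⇒m≤k k r≤s r+s≡2k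
    l : ℕ
    l = k ∸ r
    l≤k : l ≤ k
    l≤k = m∸n≤m k r
    s≡k+l : s ≡ k + l
    s≡k+l = m+n≡2k⇒n≡k+[k∸m] k r≤k r+s≡2k
    r≡k∸l : r ≡ k ∸ l
    r≡k∸l = sym (m∸[m∸n]≡n r≤k)
    n≡k*k∸l*l : n ≡ k * k ∸ l * l
    n≡k*k∸l*l = begin
      n                  ≡⟨ r*s≡n ⟨
      r * s              ≡⟨ cong₂ _*_ r≡k∸l s≡k+l ⟩
      (k ∸ l) * (k + l)  ≡⟨ [m∸n]*[m+n]≡m*m∸n*n l≤k ⟩
      k * k ∸ l * l      ∎
      where open ≡-Reasoning
    l*l≤j : l * l ≤ j
    l*l≤j = Equivalence.to (inRange[k*k∸x]⇔x≤k∸1 j (*-mono-≤ l≤k l≤k))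
      (subst (InRange k) n≡k*k∸l*l range)

  condIII⇒condII : CondIII k n r s → CondII k n r s
  condIII⇒condII (l , l*l≤j , n≡k*k∸l*l , refl , refl) =
    range , ≤-trans (m∸n≤m k l) (m≤m+n k l) , r*s≡n , [k∸l]+[k+l]≡2k l≤k
    where
    l≤k : l ≤ k
    l≤k = ≤-trans (m≤m*m l) (≤-trans l*l≤j (n≤1+n j))
    range : InRange k n
    range = subst (InRange k) (sym n≡k*k∸l*l)
      (Equivalence.from (inRange[k*k∸x]⇔x≤k∸1 j (*-mono-≤ l≤k l≤k)) l*l≤j)
    r*s≡n : (k ∸ l) * (k + l) ≡ n
    r*s≡n = trans ([m∸n]*[m+n]≡m*m∸n*n l≤k) (sym n≡k*k∸l*l)

lemma6p2 : (k : ℕ) → .{{_ : NonZero k}} → (n : ℕ) → .{{_ : NonZero n}} → (r s : ℕ) →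
    (CondI k n r s ⇔ CondII k n r s) × (CondII k n r s ⇔ CondIII k n r s)
lemma6p2 (suc j) n r s =
  mk⇔ (condI⇒condII j) (condII⇒condI j) ,
  mk⇔ (condII⇒condIII j) (condIII⇒condII j)
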